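{- The grids $(4,6,6)$, $(4,6,9)$ and $(4,9,9)$ are perfect; i.e., each grid $(a,b,c)$ among these has a vertex subset of size exactly $(ab+ac+bc)/3$ that percolates under the $3$-neighbour bootstrap percolation process.
   Context: For positive integers $a,b,c$, the grid $(a,b,c)$ is the graph $P_a\Box P_b\Box P_c$ with vertex set $[a]\times[b]\times[c]$, two vertices being adjacent iff they differ by exactly $1$ in exactly one coordinate and agree in the others. In the $3$-neighbour bootstrap percolation process, starting from $A_0\subseteq V(G)$, one sets $A_t = A_{t-1}\cup\{v : |N(v)\cap A_{t-1}|\ge 3\}$ for $t\ge1$; $A_0$ percolates if $\bigcup_t A_t = V(G)$. -}

module Defs where

open import Data.Nat using (ℕ; zero; suc; _+_; _*_; _≤ᵇ_; _≡ᵇ_)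
open import Data.Nat.DivMod using (_/_)
open import Data.Fin using (Fin; toℕ)
open import Data.Bool using (Bool; true; false; _∧_; _∨_; if_then_else_)
open import Data.Product using (_×_; _,_; ∃; proj₁; proj₂)
open import Data.List using (List; length; filterᵇ; allFin; cartesianProduct; map)
open import Data.List.Membership.Propositional using (_∈_)
open import Data.List.Relation.Unary.Unique.Propositional using (Unique)
open import Relation.Binary.PropositionalEquality using (_≡_)
open import Relation.Nullary.Decidable using (does)
open import Relation.Unary using (Pred)

-- Vertices of the grid (a,b,c) = P_a □ P_b □ P_c : [a]×[b]×[c], coordinates 0-indexed.
Vertex : ℕ → ℕ → ℕ → Set
Vertex a b c = Fin a × Fin b × Fin c

dist1 : ℕ → ℕ → Bool
dist1 x y = (suc x ≡ᵇ y) ∨ (suc y ≡ᵇ x)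

eqℕ : ℕ → ℕ → Bool
eqℕ x y = x ≡ᵇ y

adj : ∀ {a b c} → Vertex a b c → Vertex a b c → Bool
adj (x₁ , y₁ , z₁) (x₂ , y₂ , z₂) =
     (dist1 (toℕ x₁) (toℕ x₂) ∧ eqℕ (toℕ y₁) (toℕ y₂) ∧ eqℕ (toℕ z₁) (toℕ z₂))
  ∨ (eqℕ (toℕ x₁) (toℕ x₂) ∧ dist1 (toℕ y₁) (toℕ y₂) ∧ eqℕ (toℕ z₁) (toℕ z₂))
  ∨ (eqℕ (toℕ x₁) (toℕ x₂) ∧ eqℕ (toℕ y₁) (toℕ y₂) ∧ dist1 (toℕ z₁) (toℕ z₂))

allVertices : ∀ a b c → List (Vertex a b c)
allVertices a b c = cartesianProduct (allFin a) (cartesianProduct (allFin b) (allFin c))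

VSet : ℕ → ℕ → ℕ → Set
VSet a b c = Vertex a b c → Bool

nbrCount : ∀ {a b c} → VSet a b c → Vertex a b c → ℕ
nbrCount {a} {b} {c} A v =
  length (filterᵇ (λ w → adj v w ∧ A w) (allVertices a b c))

step : ∀ {a b c} → VSet a b c → VSet a b c
step A v = A v ∨ (3 ≤ᵇ nbrCount A v)

iter : ∀ {a b c} → ℕ → VSet a b c → VSet a b c
iter zero    A = A
iter (suc t) A = step (iter t A)

-- A percolates if ⋃_t A_t = V(G), i.e. every vertex lies in some A_t.
-- (The sequence is increasing, so this is the union condition.)
Percolates : ∀ {a b c} → VSet a b c → Set
Percolates A = ∀ v → ∃ λ t → iter t A v ≡ true

member : ∀ {a b c} → List (Vertex a b c) → VSet a b c
member Data.List.[] v = false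
member {a} {b} {c} (w Data.List.∷ ws) v = veq w v ∨ member ws v
  where
  veq : Vertex a b c → Vertex a b c → Bool
  veq (x₁ , y₁ , z₁) (x₂ , y₂ , z₂) =
    eqℕ (toℕ x₁) (toℕ x₂) ∧ eqℕ (toℕ y₁) (toℕ y₂) ∧ eqℕ (toℕ z₁) (toℕ z₂)

-- The grid (a,b,c) is perfect: some vertex subset of size exactly (ab+ac+bc)/3
-- percolates.  A subset of size k is given as a duplicate-free list of k vertices.
Perfect : ℕ → ℕ → ℕ → Set
Perfect a b c =
  ∃ λ (L : List (Vertex a b c)) →
    Unique L × (3 * length L ≡ a * b + a * c + b * c) × Percolates (member L)

module Submission where

-- Call τ : V → ℕ an infection schedule if every vertex with τ v = t + 1 has at least three
-- neighbours w with τ w ≤ t.  By induction on t, the zero set of τ contains every vertex v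
-- in A_{τ v}, so it percolates.  A grid is therefore perfect as soon as it carries an
-- infection schedule with exactly (ab + ac + bc)/3 zeros; for the three grids such schedules
-- are exhibited explicitly, and checking them is a finite computation.

open import Defs
open import Data.Bool using (Bool; true; T; _∧_)
open import Data.Bool.ListAction using (all)
open import Data.Bool.Properties using (T-∧; T-∨; T-≡)
open import Data.Fin using (toℕ)
open import Data.List using (List; length; filterᵇ)
open import Data.List.Membership.Propositional using (_∈_)
open import Data.List.Membership.Propositional.Properties using (∈-cartesianProduct⁺; ∈-allFin; ∈-filter⁺)
open import Data.List.Relation.Binary.Sublist.Propositional using (⊆-refl)
open import Data.List.Relation.Binary.Sublist.Propositional.Properties using (filter⁺; length-mono-≤)
import Data.List.Relation.Unary.All as All
open import Data.List.Relation.Unary.All.Properties using (all⁺)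
open import Data.List.Relation.Unary.Any using (here; there)
open import Data.List.Relation.Unary.Unique.Propositional using (Unique)
import Data.List.Relation.Unary.Unique.Propositional.Properties as Unique
open import Data.Nat using (ℕ; zero; suc; _+_; _*_; _≤_; _≤ᵇ_; _≡ᵇ_; s≤s)
open import Data.Nat.Properties using (≤-trans; ≤-refl; ≤ᵇ⇒≤; ≤⇒≤ᵇ; ≡⇒≡ᵇ; module ≤-Reasoning)
open import Data.Product using (_×_; _,_)
open import Data.Sum using (inj₁; inj₂)
open import Data.Vec as Vec using (Vec; []; _∷_)
open import Function using (_∘_; Equivalence)
open import Relation.Binary.PropositionalEquality using (_≡_; refl)
open import Relation.Nullary.Decidable using (T?)

open Equivalence using (to; from)

length-filterᵇ-mono : ∀ {X : Set} {p q : X → Bool} → (∀ x → T (p x) → T (q x)) →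
                      ∀ xs → length (filterᵇ p xs) ≤ length (filterᵇ q xs)
length-filterᵇ-mono {p = p} {q} p⇒q xs =
  length-mono-≤ (filter⁺ (T? ∘ p) (T? ∘ q) (λ { refl → p⇒q _ }) (⊆-refl {x = xs}))

module _ {a b c : ℕ} where

  ∈-allVertices : (v : Vertex a b c) → v ∈ allVertices a b c
  ∈-allVertices (x , y , z) =
    ∈-cartesianProduct⁺ (∈-allFin x) (∈-cartesianProduct⁺ (∈-allFin y) (∈-allFin z))

  allVertices-unique : Unique (allVertices a b c)
  allVertices-unique =
    Unique.cartesianProduct⁺ (Unique.allFin⁺ a)
      (Unique.cartesianProduct⁺ (Unique.allFin⁺ b) (Unique.allFin⁺ c))

  ∈⇒member : ∀ {v : Vertex a b c} {L} → v ∈ L → T (member L v)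
  ∈⇒member {v = x , y , z} (here refl) = T-∨ .from (inj₁ (T-∧ .from
    (≡⇒≡ᵇ (toℕ x) _ refl , T-∧ .from (≡⇒≡ᵇ (toℕ y) _ refl , ≡⇒≡ᵇ (toℕ z) _ refl))))
  ∈⇒member (there v∈L) = T-∨ .from (inj₂ (∈⇒member v∈L))

  nbrCount-mono : ∀ {A B : VSet a b c} → (∀ w → T (A w) → T (B w)) →
                  ∀ v → nbrCount A v ≤ nbrCount B v
  nbrCount-mono A⇒B v = length-filterᵇ-mono adj∧A⇒adj∧B (allVertices a b c)
    where
    adj∧A⇒adj∧B : ∀ w → T (adj v w ∧ _) → T (adj v w ∧ _)
    adj∧A⇒adj∧B w adj∧Aw with T-∧ .to adj∧Aw
    ... | adj-vw , Aw = T-∧ .from (adj-vw , A⇒B w Aw)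

  step-extensive : ∀ (A : VSet a b c) v → T (A v) → T (step A v)
  step-extensive A v Av = T-∨ .from (inj₁ Av)

  step-threshold : ∀ (A : VSet a b c) v → 3 ≤ nbrCount A v → T (step A v)
  step-threshold A v 3≤N = T-∨ .from (inj₂ (≤⇒≤ᵇ 3≤N))

  iter-extensive : ∀ n (A : VSet a b c) v → T (A v) → T (iter n A v)
  iter-extensive zero    A v Av = Av
  iter-extensive (suc n) A v Av = step-extensive (iter n A) v (iter-extensive n A v Av)

  onSchedule : (Vertex a b c → ℕ) → Vertex a b c → Bool
  onSchedule τ v with τ v
  ... | zero  = true
  ... | suc t = 3 ≤ᵇ nbrCount (λ w → τ w ≤ᵇ t) v

  IsInfectionSchedule : (Vertex a b c → ℕ) → Set
  IsInfectionSchedule τ = ∀ v → T (onSchedule τ v)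

  checkSchedule : ∀ τ → T (all (onSchedule τ) (allVertices a b c)) → IsInfectionSchedule τ
  checkSchedule τ onSchedule-all v = All.lookup (all⁺ _ _ onSchedule-all) (∈-allVertices v)

  seeds : (Vertex a b c → ℕ) → List (Vertex a b c)
  seeds τ = filterᵇ (λ v → τ v ≡ᵇ 0) (allVertices a b c)

  infected-by-schedule : ∀ {A : VSet a b c} {τ} → (∀ v → τ v ≡ 0 → T (A v)) →
                         IsInfectionSchedule τ → ∀ n v → τ v ≤ n → T (iter n A v)
  infected-by-schedule {A} {τ} seeded schedule n v τv≤n with τ v in τv≡ | schedule v
  ... | zero  | _ = iter-extensive n A v (seeded v τv≡)
  infected-by-schedule {A} {τ} seeded schedule (suc m) v (s≤s t≤m) | suc t | enough =
    step-threshold (iter m A) v (begin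
      3                                ≤⟨ ≤ᵇ⇒≤ 3 _ enough ⟩
      nbrCount (λ w → τ w ≤ᵇ t) v      ≤⟨ nbrCount-mono infected-earlier v ⟩
      nbrCount (iter m A) v            ∎)
    where
    open ≤-Reasoning
    infected-earlier : ∀ w → T (τ w ≤ᵇ t) → T (iter m A w)
    infected-earlier w τw≤t =
      infected-by-schedule seeded schedule m w (≤-trans (≤ᵇ⇒≤ (τ w) t τw≤t) t≤m)

  seeds-percolate : ∀ τ → IsInfectionSchedule τ → Percolates (member (seeds τ))
  seeds-percolate τ schedule v =
    τ v , T-≡ .to (infected-by-schedule seed∈seeds schedule (τ v) v ≤-refl)
    where
    seed∈seeds : ∀ v → τ v ≡ 0 → T (member (seeds τ) v)
    seed∈seeds v τv≡0 =
      ∈⇒member (∈-filter⁺ (T? ∘ λ w → τ w ≡ᵇ 0) (∈-allVertices v) (≡⇒≡ᵇ (τ v) 0 τv≡0))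

  schedule⇒perfect : ∀ τ → IsInfectionSchedule τ →
                     3 * length (seeds τ) ≡ a * b + a * c + b * c → Perfect a b c
  schedule⇒perfect τ schedule size =
    seeds τ , Unique.filter⁺ _ allVertices-unique , size , seeds-percolate τ schedule

layered : ∀ {a b c} → Vec (Vec (Vec ℕ c) b) a → Vertex a b c → ℕ
layered times (x , y , z) = Vec.lookup (Vec.lookup (Vec.lookup times x) y) z

-- The zero entries are the 28, 38 and 51 seeds respectively.
times466 : Vec (Vec (Vec ℕ 6) 6) 4
times466 =
  ( ( 9 ∷  8 ∷  7 ∷  0 ∷  7 ∷  9 ∷ []) ∷
    ( 8 ∷  7 ∷  6 ∷  5 ∷  6 ∷  8 ∷ []) ∷
    ( 5 ∷  4 ∷  0 ∷  4 ∷  5 ∷  7 ∷ []) ∷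
    ( 0 ∷  3 ∷  1 ∷  0 ∷  3 ∷  0 ∷ []) ∷
    ( 5 ∷  4 ∷  2 ∷  3 ∷  4 ∷  5 ∷ []) ∷
    ( 0 ∷  5 ∷  0 ∷  6 ∷  5 ∷  0 ∷ []) ∷ []) ∷
  ( ( 0 ∷  1 ∷  0 ∷  5 ∷  6 ∷  7 ∷ []) ∷
    ( 1 ∷  0 ∷  3 ∷  4 ∷  1 ∷  0 ∷ []) ∷
    ( 0 ∷  1 ∷  2 ∷  3 ∷  0 ∷  6 ∷ []) ∷
    ( 3 ∷  2 ∷  0 ∷  1 ∷  2 ∷  7 ∷ []) ∷
    ( 6 ∷  0 ∷  1 ∷  0 ∷  1 ∷  8 ∷ []) ∷
    (10 ∷  9 ∷  8 ∷  7 ∷  0 ∷  9 ∷ []) ∷ []) ∷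
  ( (10 ∷  9 ∷  8 ∷  7 ∷  1 ∷  0 ∷ []) ∷
    ( 9 ∷  8 ∷  7 ∷  6 ∷  0 ∷  1 ∷ []) ∷
    ( 1 ∷  0 ∷  3 ∷  5 ∷  4 ∷  5 ∷ []) ∷
    ( 9 ∷  8 ∷  7 ∷  6 ∷  3 ∷  8 ∷ []) ∷
    (10 ∷  9 ∷  8 ∷  7 ∷  0 ∷  9 ∷ []) ∷
    (11 ∷ 10 ∷  9 ∷  8 ∷  1 ∷ 10 ∷ []) ∷ []) ∷
  ( (11 ∷ 10 ∷  9 ∷  8 ∷  0 ∷  8 ∷ []) ∷
    (10 ∷  9 ∷  8 ∷  7 ∷  6 ∷  7 ∷ []) ∷
    ( 0 ∷  1 ∷  0 ∷  6 ∷  5 ∷  0 ∷ []) ∷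
    (10 ∷  9 ∷  8 ∷  7 ∷  0 ∷  9 ∷ []) ∷
    (11 ∷ 10 ∷  9 ∷  8 ∷  1 ∷ 10 ∷ []) ∷
    (12 ∷ 11 ∷ 10 ∷  9 ∷  0 ∷ 11 ∷ []) ∷ []) ∷
  []

times469 : Vec (Vec (Vec ℕ 9) 6) 4
times469 =
  ( (50 ∷  0 ∷ 32 ∷ 33 ∷  0 ∷ 41 ∷ 42 ∷ 43 ∷ 44 ∷ []) ∷
    (49 ∷ 32 ∷ 31 ∷ 30 ∷  1 ∷  2 ∷  3 ∷ 16 ∷ 21 ∷ []) ∷
    (48 ∷ 35 ∷ 28 ∷  9 ∷  0 ∷  1 ∷  2 ∷ 15 ∷  0 ∷ []) ∷
    ( 0 ∷ 36 ∷ 25 ∷  4 ∷  3 ∷  0 ∷  1 ∷ 16 ∷ 17 ∷ []) ∷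
    (42 ∷ 41 ∷ 24 ∷  0 ∷  4 ∷  5 ∷  0 ∷ 17 ∷ 18 ∷ []) ∷
    ( 0 ∷ 42 ∷  0 ∷ 22 ∷ 23 ∷ 24 ∷ 25 ∷ 26 ∷ 27 ∷ []) ∷ []) ∷
  ( ( 0 ∷  2 ∷ 31 ∷ 34 ∷ 35 ∷ 40 ∷ 41 ∷ 42 ∷ 43 ∷ []) ∷
    (48 ∷ 31 ∷ 30 ∷ 29 ∷  0 ∷  1 ∷  0 ∷ 15 ∷ 20 ∷ []) ∷
    (47 ∷ 34 ∷ 27 ∷  8 ∷  1 ∷  0 ∷  1 ∷ 14 ∷ 15 ∷ []) ∷
    (44 ∷ 37 ∷  0 ∷  3 ∷  2 ∷  1 ∷  0 ∷ 13 ∷  0 ∷ []) ∷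
    (43 ∷ 40 ∷ 23 ∷  1 ∷  0 ∷  6 ∷  7 ∷ 14 ∷ 17 ∷ []) ∷
    (44 ∷ 43 ∷ 22 ∷ 21 ∷ 20 ∷ 19 ∷ 18 ∷  0 ∷ 18 ∷ []) ∷ []) ∷
  ( (50 ∷  1 ∷  0 ∷ 35 ∷ 36 ∷ 39 ∷ 40 ∷ 41 ∷ 42 ∷ []) ∷
    (49 ∷  0 ∷ 27 ∷ 28 ∷  9 ∷  8 ∷  3 ∷  4 ∷ 19 ∷ []) ∷
    (46 ∷ 33 ∷ 26 ∷  7 ∷  6 ∷  7 ∷  2 ∷  0 ∷ 16 ∷ []) ∷
    (45 ∷ 38 ∷ 25 ∷  4 ∷  5 ∷  8 ∷  9 ∷ 12 ∷ 13 ∷ []) ∷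
    ( 0 ∷ 39 ∷ 24 ∷  0 ∷  1 ∷  9 ∷ 10 ∷ 15 ∷ 16 ∷ []) ∷
    (45 ∷ 44 ∷  0 ∷  1 ∷  0 ∷ 18 ∷ 17 ∷ 16 ∷  0 ∷ []) ∷ []) ∷
  ( (51 ∷  0 ∷ 31 ∷ 36 ∷ 37 ∷ 38 ∷  0 ∷  1 ∷  0 ∷ []) ∷
    (50 ∷ 31 ∷ 30 ∷ 29 ∷ 10 ∷  9 ∷  1 ∷  0 ∷ 18 ∷ []) ∷
    ( 0 ∷ 32 ∷  0 ∷  1 ∷  0 ∷  8 ∷  0 ∷  1 ∷ 17 ∷ []) ∷
    (46 ∷ 39 ∷ 26 ∷  0 ∷  6 ∷  9 ∷ 10 ∷ 11 ∷  0 ∷ []) ∷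
    (47 ∷ 40 ∷ 27 ∷ 14 ∷ 13 ∷ 12 ∷ 11 ∷ 16 ∷ 17 ∷ []) ∷
    (48 ∷ 45 ∷ 28 ∷ 21 ∷ 20 ∷ 19 ∷  0 ∷ 17 ∷ 18 ∷ []) ∷ []) ∷
  []

times499 : Vec (Vec (Vec ℕ 9) 9) 4
times499 =
  ( ( 0 ∷ 76 ∷ 75 ∷ 74 ∷ 73 ∷ 72 ∷  0 ∷ 78 ∷  0 ∷ []) ∷
    (66 ∷ 67 ∷ 68 ∷ 69 ∷ 70 ∷ 71 ∷ 72 ∷ 77 ∷ 78 ∷ []) ∷
    (65 ∷ 64 ∷ 45 ∷ 44 ∷  0 ∷ 44 ∷ 45 ∷ 46 ∷ 79 ∷ []) ∷
    (64 ∷ 63 ∷ 44 ∷ 43 ∷ 42 ∷ 43 ∷ 44 ∷ 45 ∷ 80 ∷ []) ∷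
    (63 ∷ 62 ∷  1 ∷  0 ∷ 41 ∷ 42 ∷ 43 ∷  0 ∷ 81 ∷ []) ∷
    (62 ∷ 61 ∷  0 ∷ 11 ∷ 40 ∷ 41 ∷ 44 ∷ 45 ∷ 82 ∷ []) ∷
    (61 ∷ 60 ∷ 41 ∷ 40 ∷ 39 ∷  0 ∷ 45 ∷ 46 ∷ 83 ∷ []) ∷
    (60 ∷ 59 ∷ 44 ∷ 41 ∷  0 ∷  1 ∷ 46 ∷ 49 ∷ 84 ∷ []) ∷
    ( 0 ∷ 58 ∷ 57 ∷ 56 ∷ 55 ∷  0 ∷ 47 ∷ 50 ∷ 85 ∷ []) ∷ []) ∷
  ( (78 ∷ 77 ∷ 18 ∷ 17 ∷ 16 ∷  0 ∷ 74 ∷ 79 ∷ 80 ∷ []) ∷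
    ( 1 ∷  0 ∷  7 ∷ 14 ∷ 15 ∷ 16 ∷ 73 ∷ 76 ∷ 77 ∷ []) ∷
    ( 0 ∷  1 ∷  0 ∷  7 ∷  8 ∷  0 ∷ 28 ∷ 33 ∷ 54 ∷ []) ∷
    ( 7 ∷  6 ∷  5 ∷  6 ∷  9 ∷ 22 ∷ 27 ∷ 32 ∷ 53 ∷ []) ∷
    ( 8 ∷  7 ∷  0 ∷  2 ∷  3 ∷ 23 ∷  0 ∷ 31 ∷ 52 ∷ []) ∷
    ( 0 ∷  8 ∷  9 ∷ 10 ∷  0 ∷ 34 ∷ 33 ∷ 32 ∷ 51 ∷ []) ∷
    ( 1 ∷  0 ∷ 40 ∷ 39 ∷ 38 ∷ 35 ∷ 34 ∷  0 ∷ 50 ∷ []) ∷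
    ( 0 ∷ 44 ∷ 43 ∷  0 ∷ 37 ∷ 36 ∷ 35 ∷ 48 ∷ 49 ∷ []) ∷
    (50 ∷ 51 ∷ 52 ∷ 53 ∷ 54 ∷ 37 ∷  0 ∷ 49 ∷  0 ∷ []) ∷ []) ∷
  ( (79 ∷ 78 ∷  0 ∷ 14 ∷  0 ∷  1 ∷ 75 ∷ 80 ∷ 81 ∷ []) ∷
    ( 0 ∷  3 ∷  6 ∷ 13 ∷ 12 ∷ 17 ∷ 74 ∷ 75 ∷  0 ∷ []) ∷
    ( 1 ∷  2 ∷  5 ∷  6 ∷ 11 ∷ 18 ∷ 27 ∷ 32 ∷ 33 ∷ []) ∷
    ( 0 ∷  3 ∷  4 ∷  0 ∷ 10 ∷ 21 ∷ 26 ∷ 31 ∷ 32 ∷ []) ∷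
    ( 9 ∷  0 ∷  2 ∷  1 ∷  0 ∷ 24 ∷ 25 ∷ 30 ∷ 31 ∷ []) ∷
    (40 ∷ 39 ∷ 38 ∷ 37 ∷ 36 ∷ 35 ∷  0 ∷ 29 ∷ 30 ∷ []) ∷
    (43 ∷ 42 ∷ 41 ∷ 40 ∷ 39 ∷ 36 ∷  1 ∷  2 ∷  0 ∷ []) ∷
    (46 ∷ 45 ∷ 42 ∷ 41 ∷ 40 ∷ 37 ∷  0 ∷ 47 ∷ 48 ∷ []) ∷
    (49 ∷ 48 ∷  0 ∷ 42 ∷ 55 ∷ 56 ∷ 57 ∷ 58 ∷ 59 ∷ []) ∷ []) ∷
  ( (80 ∷ 79 ∷ 16 ∷ 15 ∷  1 ∷  0 ∷ 76 ∷ 81 ∷ 82 ∷ []) ∷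
    (53 ∷ 16 ∷ 15 ∷ 14 ∷  0 ∷ 18 ∷ 75 ∷ 76 ∷ 77 ∷ []) ∷
    (52 ∷  0 ∷  6 ∷  0 ∷ 12 ∷ 19 ∷ 20 ∷  0 ∷ 34 ∷ []) ∷
    (51 ∷  8 ∷  7 ∷  1 ∷ 13 ∷ 20 ∷  0 ∷  1 ∷  0 ∷ []) ∷
    (50 ∷  9 ∷  8 ∷  0 ∷ 14 ∷ 25 ∷ 26 ∷ 29 ∷ 30 ∷ []) ∷
    (49 ∷ 40 ∷ 39 ∷ 38 ∷ 37 ∷ 36 ∷ 27 ∷ 28 ∷  0 ∷ []) ∷
    (48 ∷ 43 ∷ 42 ∷ 41 ∷ 40 ∷ 37 ∷  0 ∷  3 ∷  1 ∷ []) ∷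
    (47 ∷ 46 ∷ 43 ∷ 42 ∷ 43 ∷ 44 ∷ 45 ∷ 46 ∷  0 ∷ []) ∷
    ( 0 ∷ 47 ∷ 44 ∷  0 ∷ 56 ∷ 57 ∷ 58 ∷ 59 ∷ 60 ∷ []) ∷ []) ∷
  []

lemma3p3 : Perfect 4 6 6 × Perfect 4 6 9 × Perfect 4 9 9
lemma3p3 =
    schedule⇒perfect (layered times466) (checkSchedule (layered times466) _) refl
  , schedule⇒perfect (layered times469) (checkSchedule (layered times469) _) refl
  , schedule⇒perfect (layered times499) (checkSchedule (layered times499) _) refl
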